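{- There is a monotone function $\eta$ such that for every hypergraph $H$, every rooted tree decomposition $\mathbf{t}$ of $H$ and every elimination forest $F$ of $H$, the chromatic number of the conflict graph $\mathrm{CG}(\mathbf{t},F)$ is at most $\eta(\mathrm{split}(\mathbf{t},F),\mathrm{mir}(\mathbf{t},F),\mathrm{tw}(\mathbf{t}),\mathrm{rank}(H))$.
   Context: Hypergraph $H$: finite $V(H)$, edges non-empty subsets, each vertex in some edge; $\mathrm{rank}(H)$ = max edge size; vertices are adjacent if some edge contains both. A rooted tree decomposition $\mathbf{t}=(T,\mathrm{bag})$: rooted tree $T$, bags covering every edge, each vertex's bags forming a connected subtree; $\mathrm{tw}(\mathbf{t})=\max|\mathrm{bag}(x)|-1$. For node $x$ with parent $p$: $\mathrm{adh}(x)=\mathrm{bag}(x)\cap\mathrm{bag}(p)$ ($\emptyset$ at the root), $\mathrm{mrg}(x)=\mathrm{bag}(x)\setminus\mathrm{adh}(x)$, $\mathrm{cmp}(x)=\bigcup_{y\text{ descendant of }x}\mathrm{mrg}(y)$. For $u\in V(H)$, $\mathrm{mn}(u)$ is the unique node $x$ with $u\in\mathrm{mrg}(x)$. An elimination forest $F$ of $H$: rooted forest on $V(H)$ in which any two vertices of a common edge are in ancestor–descendant relation. Factors of a rooted forest ($F_x$ = descendants of $x$ incl. $x$): tree factor $F_x$; forest factor = non-empty union of tree factors with sibling roots; context factor $F_x\setminus B$ with $B$ a forest factor whose roots are strict descendants of $x$. $\mathrm{MF}(U)$ = inclusion-maximal factors contained in $U$; $U$ is well-formed if $\mathrm{MF}(U)$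 has no context factor. $\mathrm{split}(\mathbf{t},F)=\max_x|\mathrm{MF}(\mathrm{cmp}(x))|$; the irregularity of node $x$ is the number of children $y$ with $\mathrm{cmp}(y)$ not well-formed; $\mathrm{mir}(\mathbf{t},F)$ is its maximum. The stain of $u\in V(H)$ is $\mathrm{Stain}(u)=\{\mathrm{mn}(u)\}\cup\bigcup_{v \text{ child of } u \text{ in } F}\mathrm{Path}(u,v)$, where $\mathrm{Path}(u,v)$ is the vertex set of the path in $T$ from $\mathrm{mn}(u)$ to $\mathrm{mn}(v)$. The conflict graph $\mathrm{CG}(\mathbf{t},F)$ has vertex set $V(H)$, with distinct $u,v$ adjacent iff their stains intersect. -}

module Defs where

open import Data.Nat using (ℕ; zero; suc; _≤_; _⊔_; _∸_)
open import Data.Fin using (Fin; _≟_)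
open import Data.Fin.Subset using (Subset; _∈_; _⊆_; ∣_∣)
open import Data.Bool using (Bool; true; false; _∧_; _∨_; not; if_then_else_; T)
open import Data.Maybe using (Maybe; just; nothing; _>>=_)
open import Data.List using (List; []; _∷_; _++_; map; foldr; length; filter; upTo; allFin)
open import Data.Bool.ListAction using (any; all)
open import Relation.Nullary.Decidable using (T?)
open import Data.List.Membership.Propositional using () renaming (_∈_ to _∈ˡ_)
open import Data.List.Relation.Unary.All using (All)
open import Data.List.Relation.Unary.Any using (Any)
open import Data.List.Relation.Unary.Unique.Propositional using (Unique)
open import Data.Vec using (Vec; []; _∷_; lookup; tabulate)
open import Data.Product using (Σ; ∃; ∃-syntax; _×_; _,_)
open import Data.Sum using (_⊎_)
open import Relation.Nullary using (¬_; does)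
open import Relation.Unary using (Pred)
open import Relation.Binary.PropositionalEquality using (_≡_; _≢_)

anyFin : ∀ {n} → (Fin n → Bool) → Bool
anyFin f = any f (allFin _)

allFin? : ∀ {n} → (Fin n → Bool) → Bool
allFin? f = all f (allFin _)

countFin : ∀ {n} → (Fin n → Bool) → ℕ
countFin f = length (filter (λ x → T? (f x)) (allFin _))

maxFin : ∀ {n} → (Fin n → ℕ) → ℕ
maxFin f = foldr _⊔_ 0 (map f (allFin _))

_∈ᵇ_ : ∀ {n} → Fin n → Subset n → Bool
u ∈ᵇ S = lookup S u

_⊆ᵇ_ : ∀ {n} → Subset n → Subset n → Bool
S ⊆ᵇ S' = allFin? (λ u → not (u ∈ᵇ S) ∨ (u ∈ᵇ S'))

_==ᵇ_ : ∀ {n} → Subset n → Subset n → Bool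
S ==ᵇ S' = (S ⊆ᵇ S') ∧ (S' ⊆ᵇ S)

nonemptyᵇ : ∀ {n} → Subset n → Bool
nonemptyᵇ S = anyFin (λ u → u ∈ᵇ S)

allSubsets : ∀ n → List (Subset n)
allSubsets zero = [] ∷ []
allSubsets (suc n) = map (true ∷_) (allSubsets n) ++ map (false ∷_) (allSubsets n)

anySubset : ∀ {n} → (Subset n → Bool) → Bool
anySubset {n} f = any f (allSubsets n)

allSubset : ∀ {n} → (Subset n → Bool) → Bool
allSubset {n} f = all f (allSubsets n)

countSubsets : ∀ {n} → (Subset n → Bool) → ℕ
countSubsets {n} f = length (filter (λ S → T? (f S)) (allSubsets n))

eqFinᵇ : ∀ {n} → Fin n → Fin n → Bool
eqFinᵇ x y = does (x ≟ y)

eqMaybeᵇ : ∀ {n} → Maybe (Fin n) → Maybe (Fin n) → Bool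
eqMaybeᵇ nothing nothing = true
eqMaybeᵇ (just x) (just y) = eqFinᵇ x y
eqMaybeᵇ _ _ = false

record Hypergraph (n : ℕ) : Set where
  field
    edges    : List (Subset n)
    nonEmpty : All (λ e → ∃[ u ] (u ∈ e)) edges
    covered  : (u : Fin n) → Any (λ e → u ∈ e) edges

rank : ∀ {n} → Hypergraph n → ℕ
rank H = foldr _⊔_ 0 (map ∣_∣ (Hypergraph.edges H))

up : ∀ {n} → (Fin n → Maybe (Fin n)) → ℕ → Fin n → Maybe (Fin n)
up p zero v = just v
up p (suc k) v = up p k v >>= p

record RootedForest (n : ℕ) : Set where
  field
    parent  : Fin n → Maybe (Fin n)
    acyclic : (v : Fin n) → ∃[ k ] (up parent k v ≡ nothing)

record RootedTree (m : ℕ) : Set where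
  field
    forest     : RootedForest m
  open RootedForest forest public
  field
    root       : Fin m
    root-root  : parent root ≡ nothing
    root-uniq  : (x : Fin m) → parent x ≡ nothing → x ≡ root

module _ {n : ℕ} (F : RootedForest n) where
  open RootedForest F

  Anc : Fin n → Fin n → Set
  Anc a d = ∃[ k ] (up parent k d ≡ just a)

  -- boolean version; in an acyclic forest every ancestor is reached
  -- within n steps, so bounding the search by n is exact
  ancᵇ : Fin n → Fin n → Bool
  ancᵇ a d = any (λ k → eqMaybeᵇ (up parent k d) (just a)) (upTo (suc n))

  sancᵇ : Fin n → Fin n → Bool
  sancᵇ a d = ancᵇ a d ∧ not (eqFinᵇ a d)

  treeF : Fin n → Subset n
  treeF x = tabulate (λ y → ancᵇ x y)

  siblingsᵇ : Subset n → Bool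
  siblingsᵇ R = allFin? (λ r → allFin? (λ r' →
                  not (r ∈ᵇ R ∧ r' ∈ᵇ R) ∨ eqMaybeᵇ (parent r) (parent r')))

  unionTrees : Subset n → Subset n
  unionTrees R = tabulate (λ y → anyFin (λ r → r ∈ᵇ R ∧ ancᵇ r y))

  isTreeFactor : Subset n → Bool
  isTreeFactor S = anyFin (λ x → S ==ᵇ treeF x)

  isForestFactor : Subset n → Bool
  isForestFactor S = anySubset (λ R →
    nonemptyᵇ R ∧ siblingsᵇ R ∧ (S ==ᵇ unionTrees R))

  isContextFactor : Subset n → Bool
  isContextFactor S = anyFin (λ x → anySubset (λ R →
    nonemptyᵇ R ∧ siblingsᵇ R
    ∧ allFin? (λ r → not (r ∈ᵇ R) ∨ sancᵇ x r)
    ∧ (S ==ᵇ tabulate (λ y → (y ∈ᵇ treeF x) ∧ not (y ∈ᵇ unionTrees R)))))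

  isFactor : Subset n → Bool
  isFactor S = isTreeFactor S ∨ isForestFactor S ∨ isContextFactor S

  isMF : Subset n → Subset n → Bool
  isMF U S = isFactor S ∧ (S ⊆ᵇ U) ∧ not (anySubset (λ S' →
    isFactor S' ∧ (S ⊆ᵇ S') ∧ not (S ==ᵇ S') ∧ (S' ⊆ᵇ U)))

  numMF : Subset n → ℕ
  numMF U = countSubsets (isMF U)

  wellFormed : Subset n → Bool
  wellFormed U = allSubset (λ S → not (isMF U S) ∨ not (isContextFactor S))

module _ {m : ℕ} (T : RootedTree m) where
  open RootedTree T

  TAdj : Fin m → Fin m → Set
  TAdj x y = (parent x ≡ just y) ⊎ (parent y ≡ just x)

  data Walk : Fin m → Fin m → List (Fin m) → Set where
    here : ∀ {x} → Walk x x (x ∷ [])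
    step : ∀ {x y z p} → TAdj x y → Walk y z p → Walk x z (x ∷ p)

  OnPath : Fin m → Fin m → Fin m → Set
  OnPath a b z = ∃[ p ] (Walk a b p × Unique p × z ∈ˡ p)

  Connected : Pred (Fin m) _ → Set
  Connected S = ∀ x y → S x → S y → ∃[ p ] (Walk x y p × All S p)

record TreeDecomposition {n : ℕ} (H : Hypergraph n) (m : ℕ) : Set where
  field
    tree  : RootedTree m
    bag   : Fin m → Subset n
    cover : All (λ e → ∃[ x ] (e ⊆ bag x)) (Hypergraph.edges H)
    conn  : (u : Fin n) → Connected tree (λ x → u ∈ bag x)

module _ {n : ℕ} {H : Hypergraph n} {m : ℕ} (t : TreeDecomposition H m) where
  open TreeDecomposition t
  open RootedTree tree

  tw : ℕ
  tw = maxFin (λ x → ∣ bag x ∣) ∸ 1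

  adh : Fin m → Subset n
  adh x with parent x
  ... | nothing = tabulate (λ _ → false)
  ... | just p  = tabulate (λ u → u ∈ᵇ bag x ∧ u ∈ᵇ bag p)

  mrg : Fin m → Subset n
  mrg x = tabulate (λ u → u ∈ᵇ bag x ∧ not (u ∈ᵇ adh x))

  cmp : Fin m → Subset n
  cmp x = tabulate (λ u → anyFin (λ y → ancᵇ forest x y ∧ (u ∈ᵇ mrg y)))

  IsMn : Fin n → Fin m → Set
  IsMn u x = T (u ∈ᵇ mrg x)

record EliminationForest {n : ℕ} (H : Hypergraph n) : Set where
  field
    forest : RootedForest n
    elim   : All (λ e → ∀ u v → u ∈ e → v ∈ e →
                     Anc forest u v ⊎ Anc forest v u) (Hypergraph.edges H)

module _ {n : ℕ} {H : Hypergraph n} {m : ℕ}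
         (t : TreeDecomposition H m) (F : EliminationForest H) where
  open TreeDecomposition t
  private
    Fo = EliminationForest.forest F

  split : ℕ
  split = maxFin (λ x → numMF Fo (cmp t x))

  irregularity : Fin m → ℕ
  irregularity x = countFin (λ y →
    eqMaybeᵇ (RootedTree.parent tree y) (just x) ∧ not (wellFormed Fo (cmp t y)))

  mir : ℕ
  mir = maxFin irregularity

  InStain : Fin n → Fin m → Set
  InStain u z = ∃[ a ] (IsMn t u a ×
     ((z ≡ a) ⊎ ∃[ v ] (RootedForest.parent Fo v ≡ just u ×
                        ∃[ b ] (IsMn t v b × OnPath tree a b z))))

  CGAdj : Fin n → Fin n → Set
  CGAdj u v = u ≢ v × ∃[ z ] (InStain u z × InStain v z)

Colourable : ∀ {n} → (Fin n → Fin n → Set) → ℕ → Set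
Colourable {n} E k = Σ (Fin n → Fin k) (λ c → (u v : Fin n) → E u v → c u ≢ c v)

Monotone4 : (ℕ → ℕ → ℕ → ℕ → ℕ) → Set
Monotone4 η = ∀ {a a' b b' c c' d d'} → a ≤ a' → b ≤ b' → c ≤ c' → d ≤ d' →
              η a b c d ≤ η a' b' c' d'

module Submission where

-- Order the vertices by the depth of the apex of their stain (its node closest to the root),
-- breaking ties by index.  If the stains of u and w meet and w comes first, the stain of w
-- contains the apex of u.  A vertex whose stain contains a node z either lies in the bag of z,
-- or is the parent, outside cmp(z), of a vertex of cmp(z) -- and then it is the unique exit
-- point of a maximal factor of cmp(z) -- or lies in cmp(y) for a child y of z and has a child
-- outside cmp(y) -- and then it is the unique entry point of a maximal context factor of
-- cmp(y), so y is irregular.  Hence every vertex conflicts with at most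
-- (tw + 1) + split + mir · split earlier ones, and greedy colouring needs one more colour.

open import Defs
open import Data.Nat using (ℕ; zero; suc; _+_; _*_; _∸_; _⊔_; _≤_; _<_; _<?_; z≤n; s≤s; s≤s⁻¹)
open import Data.Nat.Properties
  using (≤-trans; ≤-refl; ≤-reflexive; <-≤-trans; <-cmp; <-irrefl; <-asym; <⇒≱; ≮⇒≥; ≰⇒>; _≤?_; ≤-total;
         n<1+n; m≤n⇒m≤1+n; m≤m*n; m≤m+n; m≤n+m∸n; m∸n+n≡m; m≤m⊔n; m≤n⊔m; +-comm; +-suc; +-cancelˡ-≡;
         +-mono-≤; +-monoʳ-<; *-mono-≤; *-monoˡ-≤; module ≤-Reasoning)
open import Data.Fin using (Fin; zero; suc; toℕ; _≟_) renaming (_<_ to _<ᶠ_)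
open import Data.Fin.Properties using (any?; all?; toℕ<n; toℕ-injective; pigeonhole; injective⇒≤)
open import Data.Fin.Subset using (Subset; _∈_; _∉_; _⊆_; _⊂_; _⊃_; ∣_∣; ⁅_⁆) renaming (⊥ to ∅)
open import Data.Fin.Subset.Properties
  using (_∈?_; _⊆?_; anySubset?; p⊂q⇒∣p∣<∣q∣; ∉⊥; x∈⁅x⁆; x∈⁅y⁆⇒x≡y)
open import Data.Fin.Subset.Induction using (⊃-wellFounded; Acc; acc)
open import Data.Bool using (Bool; true; false; T; _∧_; _∨_; not)
open import Data.Bool.Properties using (T-≡)
open import Data.Unit using (⊤; tt)
open import Data.Empty using (⊥; ⊥-elim)
open import Data.Maybe using (Maybe; just; nothing; _>>=_)
open import Data.Maybe.Properties using (just-injective) renaming (≡-dec to ≡-dec-Maybe)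
open import Data.List using (List; []; _∷_; _++_; length; filter; map; concatMap; foldr; allFin; upTo)
import Data.List as List
open import Data.List.Properties using (length-++; length-map; length-filter; map-cong-local)
open import Data.List.Membership.Propositional using (lose; find) renaming (_∈_ to _∈ˡ_; _∉_ to _∉ˡ_)
open import Data.List.Membership.Propositional.Properties
  using (∈-allFin; ∈-upTo⁺; ∈-map⁺; ∈-filter⁺; ∈-++⁺ˡ; ∈-++⁺ʳ; ∈-concatMap⁺)
open import Data.List.Membership.DecPropositional using () renaming (_∈?_ to member?)
open import Data.List.Relation.Unary.Any using (here; there; index)
open import Data.List.Relation.Unary.Any.Properties using (any⁺; any⁻; lookup-index)
open import Data.List.Relation.Unary.All using (All; []; _∷_)
import Data.List.Relation.Unary.All as All
open import Data.List.Relation.Unary.All.Properties using (all⁺; all⁻; all-filter; All¬⇒¬Any)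
open import Data.List.Relation.Unary.AllPairs using (_∷_)
open import Data.List.Relation.Unary.Unique.Propositional using (Unique)
open import Data.Vec using ([]; _∷_; lookup; tabulate)
open import Data.Vec.Properties using (lookup∘tabulate; tabulate∘lookup; []=⇒lookup; lookup⇒[]=)
open import Data.Product using (Σ; ∃; ∃₂; ∃-syntax; _×_; _,_; proj₁; proj₂)
open import Data.Sum using (_⊎_; inj₁; inj₂; [_,_])
open import Function.Bundles using (Equivalence)
open import Relation.Unary using (Pred; Decidable)
open import Relation.Nullary using (¬_; Dec; yes; no; ¬?)
open import Relation.Nullary.Decidable using (T?; map′; decidable-stable; _×-dec_; _⊎-dec_; _→-dec_)
open import Relation.Binary.Definitions using (tri<; tri≈; tri>)
open import Relation.Binary.PropositionalEquality
  using (_≡_; _≢_; refl; sym; trans; cong; subst; module ≡-Reasoning)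

∧⁺ : ∀ {a b} → T a → T b → T (a ∧ b)
∧⁺ {true} _ tb = tb

∧⁻ : ∀ a {b} → T (a ∧ b) → T a × T b
∧⁻ true tb = tt , tb

∨⁺ˡ : ∀ {a} b → T a → T (a ∨ b)
∨⁺ˡ {true} _ _ = tt

∨⁺ʳ : ∀ a {b} → T b → T (a ∨ b)
∨⁺ʳ true  _  = tt
∨⁺ʳ false tb = tb

∨⁻ : ∀ a {b} → T (a ∨ b) → T a ⊎ T b
∨⁻ true  _  = inj₁ tt
∨⁻ false tb = inj₂ tb

not⁺ : ∀ {a} → ¬ T a → T (not a)
not⁺ {true}  ¬ta = ¬ta tt
not⁺ {false} _   = tt

not⁻ : ∀ {a} → T (not a) → ¬ T a
not⁻ {true} ()

implies⁺ : ∀ a {b} → (T a → T b) → T (not a ∨ b)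
implies⁺ true  ta⇒tb = ta⇒tb tt
implies⁺ false _     = tt

implies⁻ : ∀ a {b} → T (not a ∨ b) → T a → T b
implies⁻ true tb _ = tb


anyFin⁺ : ∀ {n} (f : Fin n → Bool) x → T (f x) → T (anyFin f)
anyFin⁺ f x fx = any⁺ f (lose (∈-allFin x) fx)

anyFin⁻ : ∀ {n} (f : Fin n → Bool) → T (anyFin f) → ∃[ x ] T (f x)
anyFin⁻ {n} f h with find (any⁻ f (allFin n) h)
... | x , _ , fx = x , fx

allFin⁺ : ∀ {n} (f : Fin n → Bool) → (∀ x → T (f x)) → T (allFin? f)
allFin⁺ {n} f all-f = all⁻ f {allFin n} (All.tabulate λ {x} _ → all-f x)

allFin⁻ : ∀ {n} (f : Fin n → Bool) → T (allFin? f) → ∀ x → T (f x)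
allFin⁻ {n} f h x = All.lookup (all⁺ f (allFin n) h) (∈-allFin x)

∈-allSubsets : ∀ {n} (S : Subset n) → S ∈ˡ allSubsets n
∈-allSubsets []           = here refl
∈-allSubsets (true ∷ S)   = ∈-++⁺ˡ (∈-map⁺ (true ∷_) (∈-allSubsets S))
∈-allSubsets {suc n} (false ∷ S) = ∈-++⁺ʳ (map (true ∷_) (allSubsets n)) (∈-map⁺ (false ∷_) (∈-allSubsets S))

anySubset⁺ : ∀ {n} (f : Subset n → Bool) S → T (f S) → T (anySubset f)
anySubset⁺ f S fS = any⁺ f (lose (∈-allSubsets S) fS)

anySubset⁻ : ∀ {n} (f : Subset n → Bool) → T (anySubset f) → ∃[ S ] T (f S)
anySubset⁻ {n} f h with find (any⁻ f (allSubsets n) h)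
... | S , _ , fS = S , fS

allSubset⁻ : ∀ {n} (f : Subset n → Bool) → T (allSubset f) → ∀ S → T (f S)
allSubset⁻ {n} f h S = All.lookup (all⁺ f (allSubsets n) h) (∈-allSubsets S)


∈ᵇ⁺ : ∀ {n} {u : Fin n} {S} → u ∈ S → T (u ∈ᵇ S)
∈ᵇ⁺ u∈S rewrite []=⇒lookup u∈S = tt

∈ᵇ⁻ : ∀ {n} {u : Fin n} {S} → T (u ∈ᵇ S) → u ∈ S
∈ᵇ⁻ {u = u} {S} h = lookup⇒[]= u S (Equivalence.to T-≡ h)

∈-tabulate⁺ : ∀ {n} {f : Fin n → Bool} {u} → T (f u) → u ∈ tabulate f
∈-tabulate⁺ {f = f} {u} fu = ∈ᵇ⁻ (subst T (sym (lookup∘tabulate f u)) fu)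

∈-tabulate⁻ : ∀ {n} {f : Fin n → Bool} {u} → u ∈ tabulate f → T (f u)
∈-tabulate⁻ {f = f} {u} u∈ = subst T (lookup∘tabulate f u) (∈ᵇ⁺ u∈)

⊆ᵇ⁺ : ∀ {n} {S S' : Subset n} → S ⊆ S' → T (S ⊆ᵇ S')
⊆ᵇ⁺ {S = S} S⊆S' = allFin⁺ _ λ u → implies⁺ (u ∈ᵇ S) λ u∈S → ∈ᵇ⁺ (S⊆S' (∈ᵇ⁻ u∈S))

⊆ᵇ⁻ : ∀ {n} {S S' : Subset n} → T (S ⊆ᵇ S') → S ⊆ S'
⊆ᵇ⁻ {S = S} {S'} h {u} u∈S =
  ∈ᵇ⁻ (implies⁻ (u ∈ᵇ S) (allFin⁻ (λ u → not (u ∈ᵇ S) ∨ (u ∈ᵇ S')) h u) (∈ᵇ⁺ u∈S))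

==ᵇ⁺ : ∀ {n} {S S' : Subset n} → S ⊆ S' → S' ⊆ S → T (S ==ᵇ S')
==ᵇ⁺ S⊆S' S'⊆S = ∧⁺ (⊆ᵇ⁺ S⊆S') (⊆ᵇ⁺ S'⊆S)

==ᵇ⁻ : ∀ {n} {S S' : Subset n} → T (S ==ᵇ S') → S ⊆ S' × S' ⊆ S
==ᵇ⁻ {S = S} {S'} h with ∧⁻ (S ⊆ᵇ S') h
... | S⊆S' , S'⊆S = ⊆ᵇ⁻ S⊆S' , ⊆ᵇ⁻ S'⊆S

eqFinᵇ⁺ : ∀ {n} {x y : Fin n} → x ≡ y → T (eqFinᵇ x y)
eqFinᵇ⁺ {x = x} {y} x≡y with x ≟ y
... | yes _   = tt
... | no x≢y = x≢y x≡y

eqFinᵇ⁻ : ∀ {n} {x y : Fin n} → T (eqFinᵇ x y) → x ≡ y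
eqFinᵇ⁻ {x = x} {y} h with x ≟ y
... | yes x≡y = x≡y

eqMaybeᵇ⁺ : ∀ {n} {x y : Maybe (Fin n)} → x ≡ y → T (eqMaybeᵇ x y)
eqMaybeᵇ⁺ {x = nothing} refl = tt
eqMaybeᵇ⁺ {x = just x}  refl = eqFinᵇ⁺ {x = x} refl

eqMaybeᵇ⁻ : ∀ {n} {x y : Maybe (Fin n)} → T (eqMaybeᵇ x y) → x ≡ y
eqMaybeᵇ⁻ {x = nothing} {nothing} _ = refl
eqMaybeᵇ⁻ {x = just x}  {just y}  h = cong just (eqFinᵇ⁻ h)


module _ {A B : Set} (P : A → B → Set) (P? : ∀ a → Dec (∃ (P a))) where

  witnesses : List A → List B
  witnesses []       = []
  witnesses (a ∷ as) with P? a
  ... | yes (b , _) = b ∷ witnesses as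
  ... | no  _       = witnesses as

  length-witnesses : ∀ as → length (witnesses as) ≤ length as
  length-witnesses []       = z≤n
  length-witnesses (a ∷ as) with P? a
  ... | yes _ = s≤s (length-witnesses as)
  ... | no  _ = m≤n⇒m≤1+n (length-witnesses as)

  ∈-witnesses : ∀ {a b as} → a ∈ˡ as → P a b → (∀ {b'} → P a b' → b' ≡ b) → b ∈ˡ witnesses as
  ∈-witnesses {as = a ∷ as} (here refl) Pab unique with P? a
  ... | yes (b' , Pab') = here (sym (unique Pab'))
  ... | no  none        = ⊥-elim (none (_ , Pab))
  ∈-witnesses {as = a' ∷ as} (there a∈) Pab unique with P? a'
  ... | yes _ = there (∈-witnesses a∈ Pab unique)
  ... | no  _ = ∈-witnesses a∈ Pab unique

Maximal : ∀ {n ℓ} → Pred (Subset n) ℓ → Pred (Subset n) ℓ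
Maximal Q M = Q M × ∀ {S} → Q S → M ⊆ S → S ⊆ M

maximal-above : ∀ {n ℓ} {Q : Pred (Subset n) ℓ} → Decidable Q → ∀ {S} → Q S → ∃[ M ] (S ⊆ M × Maximal Q M)
maximal-above {Q = Q} Q? {S} QS = grow (⊃-wellFounded S) QS
  where
  _⊂?_ : ∀ S S' → Dec (S ⊂ S')
  S ⊂? S' = (S ⊆? S') ×-dec any? (λ x → x ∈? S' ×-dec ¬? (x ∈? S))

  grow : ∀ {S} → Acc _⊃_ S → Q S → ∃[ M ] (S ⊆ M × Maximal Q M)
  grow {S} (acc larger) QS with anySubset? (λ S' → Q? S' ×-dec S ⊂? S')
  ... | yes (S' , QS' , S⊂S'@(S⊆S' , _)) with grow (larger S⊂S') QS'
  ...   | M , S'⊆M , maximal = M , (λ x∈ → S'⊆M (S⊆S' x∈)) , maximal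
  grow {S} (acc larger) QS | no none =
    S , (λ x∈ → x∈) , QS , λ {S'} QS' S⊆S' {x} x∈S' →
      decidable-stable (x ∈? S) (λ x∉S → none (S' , QS' , S⊆S' , x , x∈S' , x∉S))

length-filter-tabulate : ∀ {k} {A : Set} (P : A → Bool) (f : Fin k → A) →
                         length (filter (λ x → T? (P x)) (List.tabulate f)) ≡ ∣ tabulate (λ i → P (f i)) ∣
length-filter-tabulate {zero}  P f = refl
length-filter-tabulate {suc k} P f with P (f zero)
... | true  = cong suc (length-filter-tabulate P (λ i → f (suc i)))
... | false = length-filter-tabulate P (λ i → f (suc i))

maxFin-≥ : ∀ {k} (f : Fin k → ℕ) x → f x ≤ maxFin f
maxFin-≥ {k} f x = go (allFin k) (∈-allFin x)
  where
  go : ∀ xs → x ∈ˡ xs → f x ≤ foldr _⊔_ 0 (map f xs)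
  go (y ∷ ys) (here refl) = m≤m⊔n (f y) _
  go (y ∷ ys) (there x∈) = ≤-trans (go ys x∈) (m≤n⊔m (f y) _)

length-concatMap-≤ : ∀ {A B : Set} (g : A → List B) {k} → (∀ x → length (g x) ≤ k) →
                     ∀ xs → length (concatMap g xs) ≤ length xs * k
length-concatMap-≤ g short []       = z≤n
length-concatMap-≤ g short (x ∷ xs) = begin
  length (g x ++ concatMap g xs)          ≡⟨ length-++ (g x) ⟩
  length (g x) + length (concatMap g xs)  ≤⟨ +-mono-≤ (short x) (length-concatMap-≤ g short xs) ⟩
  _ + length xs * _                       ∎
  where open ≤-Reasoning

radix-< : ∀ {n a b} (i j : Fin n) → a < b → a * n + toℕ i < b * n + toℕ j
radix-< {n} {a} {b} i j a<b = begin-strict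
  a * n + toℕ i  <⟨ +-monoʳ-< (a * n) (toℕ<n i) ⟩
  a * n + n      ≡⟨ +-comm (a * n) n ⟩
  suc a * n      ≤⟨ *-monoˡ-≤ n a<b ⟩
  b * n          ≤⟨ m≤m+n (b * n) (toℕ j) ⟩
  b * n + toℕ j  ∎
  where open ≤-Reasoning

radix-injective : ∀ {n a b} (i j : Fin n) → a * n + toℕ i ≡ b * n + toℕ j → i ≡ j
radix-injective {n} {a} {b} i j eq with <-cmp a b
... | tri< a<b _ _ = ⊥-elim (<-irrefl eq (radix-< i j a<b))
... | tri> _ _ b<a = ⊥-elim (<-irrefl (sym eq) (radix-< j i b<a))
... | tri≈ _ refl _ = toℕ-injective (+-cancelˡ-≡ (a * n) (toℕ i) (toℕ j) eq)

radix-≤ : ∀ {n a b} (i j : Fin n) → a * n + toℕ i < b * n + toℕ j → a ≤ b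
radix-≤ {a = a} {b} i j lt with a ≤? b
... | yes a≤b = a≤b
... | no  a≰b = ⊥-elim (<-asym lt (radix-< j i (≰⇒> a≰b)))

fresh : ∀ {k} → List (Fin (suc k)) → Fin (suc k)
fresh xs with any? (λ c → ¬? (member? _≟_ c xs))
... | yes (c , _) = c
... | no _        = zero

-- If every colour occurred in xs, positions in xs would inject Fin (suc k) into Fin (length xs).
fresh-∉ : ∀ {k} (xs : List (Fin (suc k))) → length xs < suc k → fresh xs ∉ˡ xs
fresh-∉ {k} xs short with any? (λ c → ¬? (member? _≟_ c xs))
... | yes (_ , c∉xs) = c∉xs
... | no no-fresh    = λ _ → <-irrefl refl (<-≤-trans short (injective⇒≤ position-injective))
  where
  member : ∀ c → c ∈ˡ xs
  member c = decidable-stable (member? _≟_ c xs) (λ c∉xs → no-fresh (c , c∉xs))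
  position-injective : ∀ {c d} → index (member c) ≡ index (member d) → c ≡ d
  position-injective {c} {d} eq =
    trans (lookup-index (member c)) (trans (cong (List.lookup xs) eq) (sym (lookup-index (member d))))

module GreedyColouring {n B : ℕ} (priority : Fin n → ℕ) (candidates : Fin n → List (Fin n))
                       (few-candidates : ∀ u → length (candidates u) ≤ B) where

  earlier : Fin n → List (Fin n)
  earlier u = filter (λ w → priority w <? priority u) (candidates u)

  colourWithin : ℕ → Fin n → Fin (suc B)
  colourWithin zero    _ = zero
  colourWithin (suc k) u = fresh (map (colourWithin k) (earlier u))

  -- Fuel k lets the colouring look k priority levels down; any fuel above priority u gives colour u.
  colour : Fin n → Fin (suc B)
  colour u = colourWithin (suc (priority u)) u

  colourWithin-stable : ∀ j k u → priority u < j → priority u < k → colourWithin j u ≡ colourWithin k u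
  colourWithin-stable (suc j) (suc k) u (s≤s pu≤j) (s≤s pu≤k) =
    cong fresh (map-cong-local (All.map agree (all-filter (λ w → priority w <? priority u) (candidates u))))
    where
    agree : ∀ {w} → priority w < priority u → colourWithin j w ≡ colourWithin k w
    agree pw<pu = colourWithin-stable j k _ (<-≤-trans pw<pu pu≤j) (<-≤-trans pw<pu pu≤k)

  colour-≢-earlier : ∀ {u w} → w ∈ˡ candidates u → priority w < priority u → colour u ≢ colour w
  colour-≢-earlier {u} {w} w∈ pw<pu cu≡cw = fresh-∉ used short (subst (_∈ˡ used) w-colour w-used)
    where
    used = map (colourWithin (priority u)) (earlier u)
    w-used : colourWithin (priority u) w ∈ˡ used
    w-used = ∈-map⁺ (colourWithin (priority u)) (∈-filter⁺ (λ w → priority w <? priority u) w∈ pw<pu)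
    w-colour : colourWithin (priority u) w ≡ colour u
    w-colour = trans (colourWithin-stable (priority u) (suc (priority w)) w pw<pu (s≤s ≤-refl)) (sym cu≡cw)
    short : length used < suc B
    short = s≤s (≤-trans (≤-reflexive (length-map _ (earlier u)))
                  (≤-trans (length-filter (λ w → priority w <? priority u) (candidates u)) (few-candidates u)))

greedy-colourable : ∀ {n B} (E : Fin n → Fin n → Set) (priority : Fin n → ℕ)
                    (candidates : Fin n → List (Fin n)) →
  (∀ u → length (candidates u) ≤ B) →
  (∀ {u w} → E u w → E w u) →
  (∀ {u w} → E u w → priority u ≢ priority w) →
  (∀ {u w} → E u w → priority w < priority u → w ∈ˡ candidates u) →
  Colourable E (suc B)
greedy-colourable E priority candidates few sym-E distinct listed = colour , proper
  where
  open GreedyColouring priority candidates few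
  proper : ∀ u w → E u w → colour u ≢ colour w
  proper u w e with <-cmp (priority u) (priority w)
  ... | tri< pu<pw _ _ = λ cu≡cw → colour-≢-earlier (listed (sym-E e) pu<pw) pu<pw (sym cu≡cw)
  ... | tri≈ _ pu≡pw _ = λ _ → distinct e pu≡pw
  ... | tri> _ _ pw<pu = colour-≢-earlier (listed e pw<pu) pw<pu

module Ancestry {n : ℕ} (F : RootedForest n) where
  open RootedForest F

  infix 4 _≼_
  _≼_ : Fin n → Fin n → Set
  _≼_ = Anc F

  private
    ↑ : ℕ → Fin n → Maybe (Fin n)
    ↑ = up parent

  up-+-just : ∀ k {j v x} → ↑ j v ≡ just x → ↑ (k + j) v ≡ ↑ k x
  up-+-just zero    eq = eq
  up-+-just (suc k) eq = cong (_>>= parent) (up-+-just k eq)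

  up-+-nothing : ∀ k {j v} → ↑ j v ≡ nothing → ↑ (k + j) v ≡ nothing
  up-+-nothing zero    eq = eq
  up-+-nothing (suc k) {j} {v} eq rewrite up-+-nothing k {j} {v} eq = refl

  up-mono-nothing : ∀ {j l v} → j ≤ l → ↑ j v ≡ nothing → ↑ l v ≡ nothing
  up-mono-nothing {j} {l} {v} j≤l eq =
    subst (λ i → ↑ i v ≡ nothing) (m∸n+n≡m j≤l) (up-+-nothing (l ∸ j) eq)

  up-suc : ∀ k v → ↑ (suc k) v ≡ (parent v >>= ↑ k)
  up-suc k v with parent v in eq
  ... | just p  = trans (cong (λ i → ↑ i v) (+-comm 1 k)) (up-+-just k eq)
  ... | nothing = trans (cong (λ i → ↑ i v) (+-comm 1 k)) (up-+-nothing k eq)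

  -- Iterating a cycle of length suc k would never reach a root.
  no-cycle : ∀ k x → ↑ (suc k) x ≢ just x
  no-cycle k x cycle with acyclic x
  ... | l , ends = just≢nothing (trans (sym (iterate l)) (up-mono-nothing (m≤m*n l (suc k)) ends))
    where
    iterate : ∀ i → ↑ (i * suc k) x ≡ just x
    iterate zero    = refl
    iterate (suc i) = trans (up-+-just (suc k) (iterate i)) cycle
    just≢nothing : just x ≢ nothing
    just≢nothing ()

  ≼-refl : ∀ {x} → x ≼ x
  ≼-refl = 0 , refl

  ≼-trans : ∀ {a b c} → a ≼ b → b ≼ c → a ≼ c
  ≼-trans (k , b→a) (j , c→b) = k + j , trans (up-+-just k c→b) b→a

  parent-≼ : ∀ {a d} → parent d ≡ just a → a ≼ d
  parent-≼ eq = 1 , eq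

  ≼-antisym : ∀ {a b} → a ≼ b → b ≼ a → a ≡ b
  ≼-antisym (zero , b→a)  _            = sym (just-injective b→a)
  ≼-antisym {a} (suc k , b→a) (j , a→b) = ⊥-elim (no-cycle (k + j) a (trans (up-+-just (suc k) a→b) b→a))

  ≼-linear : ∀ {a b d} → a ≼ d → b ≼ d → a ≼ b ⊎ b ≼ a
  ≼-linear {a} {b} {d} (k , d→a) (j , d→b) with ≤-total k j
  ... | inj₁ k≤j = inj₂ (j ∸ k , trans (sym (up-+-just (j ∸ k) d→a))
                                       (trans (cong (λ i → ↑ i d) (m∸n+n≡m k≤j)) d→b))
  ... | inj₂ j≤k = inj₁ (k ∸ j , trans (sym (up-+-just (k ∸ j) d→b))
                                       (trans (cong (λ i → ↑ i d) (m∸n+n≡m j≤k)) d→a))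

  ≺-child : ∀ {a d} → a ≼ d → a ≢ d → ∃[ y ] (parent y ≡ just a × y ≼ d)
  ≺-child (zero  , refl) a≢d = ⊥-elim (a≢d refl)
  ≺-child {a} {d} (suc k , d→a) _ with ↑ k d in d→y
  ... | just y = y , d→a , k , d→y

  ≺-parent : ∀ {a d} → a ≼ d → a ≢ d → ∃[ p ] (parent d ≡ just p × a ≼ p)
  ≺-parent (zero  , refl) a≢d = ⊥-elim (a≢d refl)
  ≺-parent {a} {d} (suc k , d→a) _ with parent d in d→p | up-suc k d
  ... | just p  | eq = p , refl , k , trans (sym eq) d→a
  ... | nothing | eq with trans (sym eq) d→a
  ... | ()

  child-⋠ : ∀ {y v} → parent y ≡ just v → ¬ y ≼ v
  child-⋠ {y} y→v y≼v with ≼-antisym y≼v (parent-≼ y→v)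
  ... | refl = no-cycle 0 y y→v

  ≼⇒≼parent⊎≡ : ∀ {a r p} → parent r ≡ just p → a ≼ r → a ≼ p ⊎ a ≡ r
  ≼⇒≼parent⊎≡ {a} {r} r→p a≼r with a ≟ r
  ... | yes a≡r = inj₂ a≡r
  ... | no  a≢r with ≺-parent a≼r a≢r
  ... | p' , r→p' , a≼p' rewrite just-injective (trans (sym r→p) r→p') = inj₁ a≼p'

  up-defined-below : ∀ {k i d a} → ↑ k d ≡ just a → i ≤ k → ∃[ x ] (↑ i d ≡ just x)
  up-defined-below {k} {i} {d} d→a i≤k with ↑ i d in eq
  ... | just x  = x , refl
  ... | nothing with trans (sym d→a) (up-mono-nothing i≤k eq)
  ... | ()

  -- Among n + 1 iterated parents two coincide, which would close a cycle.
  up-< : ∀ {k d a} → ↑ k d ≡ just a → k < n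
  up-< {k} {d} d→a with k <? n
  ... | yes k<n = k<n
  ... | no  k≮n = ⊥-elim (repeat (pigeonhole (n<1+n n) node))
    where
    node : Fin (suc n) → Fin n
    node i = proj₁ (up-defined-below d→a (≤-trans (s≤s⁻¹ (toℕ<n i)) (≮⇒≥ k≮n)))
    reaches : ∀ i → ↑ (toℕ i) d ≡ just (node i)
    reaches i = proj₂ (up-defined-below d→a (≤-trans (s≤s⁻¹ (toℕ<n i)) (≮⇒≥ k≮n)))
    repeat : ∃₂ (λ i j → i <ᶠ j × node i ≡ node j) → ⊥
    repeat (i , j , i<j , same) = no-cycle gap (node i) (begin
        ↑ (suc gap) (node i)     ≡⟨ up-+-just (suc gap) (reaches i) ⟨
        ↑ (suc gap + toℕ i) d    ≡⟨ cong (λ l → ↑ l d) span ⟩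
        ↑ (toℕ j) d              ≡⟨ reaches j ⟩
        just (node j)            ≡⟨ cong just same ⟨
        just (node i)            ∎)
      where
      open ≡-Reasoning
      gap = toℕ j ∸ suc (toℕ i)
      span : suc gap + toℕ i ≡ toℕ j
      span = trans (sym (+-suc gap (toℕ i))) (m∸n+n≡m i<j)

  ancᵇ⁻ : ∀ {a d} → T (ancᵇ F a d) → a ≼ d
  ancᵇ⁻ {a} {d} h with find (any⁻ _ (upTo (suc n)) h)
  ... | k , _ , d→a = k , eqMaybeᵇ⁻ d→a

  ancᵇ⁺ : ∀ {a d} → a ≼ d → T (ancᵇ F a d)
  ancᵇ⁺ {a} {d} (k , d→a) =
    any⁺ (λ k → eqMaybeᵇ (↑ k d) (just a)) (lose {x = k} (∈-upTo⁺ (m≤n⇒m≤1+n (up-< d→a))) (eqMaybeᵇ⁺ d→a))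

  infix 4 _≼?_
  _≼?_ : ∀ a d → Dec (a ≼ d)
  a ≼? d = map′ ancᵇ⁻ ancᵇ⁺ (T? (ancᵇ F a d))

  ∈-treeF⁺ : ∀ {x w} → x ≼ w → w ∈ treeF F x
  ∈-treeF⁺ x≼w = ∈-tabulate⁺ (ancᵇ⁺ x≼w)

  ∈-treeF⁻ : ∀ {x w} → w ∈ treeF F x → x ≼ w
  ∈-treeF⁻ {x} w∈ = ancᵇ⁻ (∈-tabulate⁻ {f = ancᵇ F x} w∈)

  highest-ancestor : ∀ {p} {P : Pred (Fin n) p} → Decidable P → ∀ {x} → P x →
                     ∃[ r ] (r ≼ x × P r × ∀ {q} → parent r ≡ just q → ¬ P q)
  highest-ancestor {P = P} P? {x} Px = climb (proj₁ (acyclic x)) ≼-refl Px (proj₂ (acyclic x))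
    where
    climb : ∀ l {y} → y ≼ x → P y → ↑ l y ≡ nothing →
            ∃[ r ] (r ≼ x × P r × ∀ {q} → parent r ≡ just q → ¬ P q)
    climb (suc l) {y} y≼x Py ends with parent y in y→q | up-suc l y
    ... | nothing | _ = y , y≼x , Py , λ y→q' _ → nothing≢just (trans (sym y→q) y→q')
      where nothing≢just : ∀ {q} → nothing ≢ just q
            nothing≢just ()
    ... | just q | ends-from-q with P? q
    ...   | yes Pq = climb l (≼-trans (parent-≼ y→q) y≼x) Pq (trans (sym ends-from-q) ends)
    ...   | no ¬Pq = y , y≼x , Py , λ y→q' Pq' → ¬Pq (subst P (just-injective (trans (sym y→q') y→q)) Pq')

  root-above : ∀ x → ∃[ r ] (r ≼ x × parent r ≡ nothing)
  root-above x with highest-ancestor {P = λ _ → ⊤} (λ _ → yes tt) tt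
  ... | r , r≼x , _ , highest with parent r in r→q
  ... | nothing = r , r≼x , r→q
  ... | just q  = ⊥-elim (highest refl tt)

  ancestors : Fin n → Subset n
  ancestors x = tabulate (λ c → ancᵇ F c x)

  ∈-ancestors⁺ : ∀ {c x} → c ≼ x → c ∈ ancestors x
  ∈-ancestors⁺ c≼x = ∈-tabulate⁺ (ancᵇ⁺ c≼x)

  ∈-ancestors⁻ : ∀ {c x} → c ∈ ancestors x → c ≼ x
  ∈-ancestors⁻ {c} {x} c∈ = ancᵇ⁻ (∈-tabulate⁻ {f = λ c → ancᵇ F c x} c∈)

  depth : Fin n → ℕ
  depth x = ∣ ancestors x ∣

  depth-< : ∀ {a d} → a ≼ d → a ≢ d → depth a < depth d
  depth-< {a} {d} a≼d a≢d = p⊂q⇒∣p∣<∣q∣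
    ( (λ c∈ → ∈-ancestors⁺ (≼-trans (∈-ancestors⁻ c∈) a≼d))
    , d , ∈-ancestors⁺ ≼-refl , λ d∈ → a≢d (≼-antisym a≼d (∈-ancestors⁻ d∈)))

  ≼-depth-≤⇒≡ : ∀ {a d} → a ≼ d → depth d ≤ depth a → a ≡ d
  ≼-depth-≤⇒≡ {a} {d} a≼d shallower with a ≟ d
  ... | yes a≡d = a≡d
  ... | no  a≢d = ⊥-elim (<⇒≱ (depth-< a≼d a≢d) shallower)

module TreeProperties {m : ℕ} (T : RootedTree m) where
  open RootedTree T
  open Ancestry forest public

  lowest-common-ancestor : ∀ a b → ∃[ c ] (c ≼ a × c ≼ b × ∀ {c'} → c' ≼ a → c' ≼ b → c' ≼ c)
  lowest-common-ancestor a b with a ≼? b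
  ... | yes a≼b = a , ≼-refl , a≼b , λ c'≼a _ → c'≼a
  ... | no  a⋠b with highest-ancestor (λ x → ¬? (x ≼? b)) a⋠b
  ... | r , r≼a , r⋠b , parent-≼b with parent r in r→p
  ... | nothing = ⊥-elim (r⋠b r≼b)
    where
    r≼b : r ≼ b
    r≼b with root-above b
    ... | r' , r'≼b , r'-root rewrite root-uniq r r→p | root-uniq r' r'-root = r'≼b
  ... | just p = p , ≼-trans (parent-≼ r→p) r≼a , p≼b , lowest
    where
    p≼b : p ≼ b
    p≼b = decidable-stable (p ≼? b) (parent-≼b refl)
    lowest : ∀ {c'} → c' ≼ a → c' ≼ b → c' ≼ p
    lowest c'≼a c'≼b with ≼-linear r≼a c'≼a
    ... | inj₁ r≼c' = ⊥-elim (r⋠b (≼-trans r≼c' c'≼b))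
    ... | inj₂ c'≼r with ≼⇒≼parent⊎≡ r→p c'≼r
    ... | inj₁ c'≼p = c'≼p
    ... | inj₂ refl = ⊥-elim (r⋠b c'≼b)

  leaving-edge : ∀ {c x y} → TAdj T x y → c ≼ x → ¬ c ≼ y → x ≡ c × parent c ≡ just y
  leaving-edge (inj₂ y→x) c≼x c⋠y = ⊥-elim (c⋠y (≼-trans c≼x (parent-≼ y→x)))
  leaving-edge (inj₁ x→y) c≼x c⋠y with ≼⇒≼parent⊎≡ x→y c≼x
  ... | inj₁ c≼y = ⊥-elim (c⋠y c≼y)
  ... | inj₂ refl = refl , x→y

  entering-edge : ∀ {c x y} → TAdj T x y → ¬ c ≼ x → c ≼ y → y ≡ c × parent c ≡ just x
  entering-edge (inj₁ x→y) = λ c⋠x c≼y → leaving-edge (inj₂ x→y) c≼y c⋠x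
  entering-edge (inj₂ y→x) = λ c⋠x c≼y → leaving-edge (inj₁ y→x) c≼y c⋠x

  walk-start : ∀ {x y p} → Walk T x y p → x ∈ˡ p
  walk-start here       = here refl
  walk-start (step _ _) = here refl

  walk-leaves : ∀ {c x y p} → Walk T x y p → c ≼ x → ¬ c ≼ y →
                c ∈ˡ p × ∃[ pc ] (parent c ≡ just pc × pc ∈ˡ p)
  walk-leaves here c≼x c⋠y = ⊥-elim (c⋠y c≼x)
  walk-leaves {c} (step {y = x'} adj w) c≼x c⋠y with c ≼? x'
  ... | yes c≼x' with walk-leaves w c≼x' c⋠y
  ...   | c∈ , pc , c→pc , pc∈ = there c∈ , pc , c→pc , there pc∈
  walk-leaves {c} (step {y = x'} adj w) c≼x c⋠y | no c⋠x' with leaving-edge adj c≼x c⋠x'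
  ...   | refl , c→x' = here refl , x' , c→x' , there (walk-start w)

  walk-enters : ∀ {c x y p} → Walk T x y p → ¬ c ≼ x → c ≼ y → c ∈ˡ p
  walk-enters here c⋠x c≼y = ⊥-elim (c⋠x c≼y)
  walk-enters {c} (step {y = x'} adj w) c⋠x c≼y with c ≼? x'
  ... | no  c⋠x' = there (walk-enters w c⋠x' c≼y)
  ... | yes c≼x' with entering-edge adj c⋠x c≼x'
  ...   | refl , _ = there (walk-start w)

  -- A walk that left the subtree of c and came back would visit c twice.
  unique-walk-stays-below : ∀ {c x y p} → Walk T x y p → Unique p → c ≼ x → c ≼ y → All (c ≼_) p
  unique-walk-stays-below here _ c≼x _ = c≼x ∷ []
  unique-walk-stays-below {c} (step {y = x'} adj w) (x∉ ∷ u) c≼x c≼y with c ≼? x'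
  ... | yes c≼x' = c≼x ∷ unique-walk-stays-below w u c≼x' c≼y
  ... | no  c⋠x' with leaving-edge adj c≼x c⋠x'
  ...   | refl , _ = ⊥-elim (All¬⇒¬Any x∉ (walk-enters w c⋠x' c≼y))

  -- A walk that entered the subtree of c and left again would visit its parent twice.
  unique-walk-avoids : ∀ {c x y p} → Walk T x y p → Unique p → ¬ c ≼ x → ¬ c ≼ y → All (λ z → ¬ c ≼ z) p
  unique-walk-avoids here _ c⋠x _ = c⋠x ∷ []
  unique-walk-avoids {c} (step {y = x'} adj w) (x∉ ∷ u) c⋠x c⋠y with c ≼? x'
  ... | no  c⋠x' = c⋠x ∷ unique-walk-avoids w u c⋠x' c⋠y
  ... | yes c≼x' with entering-edge adj c⋠x c≼x'
  ...   | refl , c→x with walk-leaves w c≼x' c⋠y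
  ...     | _ , pc , c→pc , pc∈ with trans (sym c→x) c→pc
  ...       | refl = ⊥-elim (All¬⇒¬Any x∉ pc∈)

  on-path-≼ : ∀ {a b z} → OnPath T a b z → z ≼ a ⊎ z ≼ b
  on-path-≼ {a} {b} {z} (p , w , u , z∈) with z ≼? a | z ≼? b
  ... | yes z≼a | _       = inj₁ z≼a
  ... | no  _   | yes z≼b = inj₂ z≼b
  ... | no  z⋠a | no  z⋠b = ⊥-elim (All.lookup (unique-walk-avoids w u z⋠a z⋠b) z∈ ≼-refl)

  common-ancestor-≼-on-path : ∀ {a b z c} → OnPath T a b z → c ≼ a → c ≼ b → c ≼ z
  common-ancestor-≼-on-path (p , w , u , z∈) c≼a c≼b = All.lookup (unique-walk-stays-below w u c≼a c≼b) z∈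

module DecompositionProperties {n : ℕ} {H : Hypergraph n} {m : ℕ} (t : TreeDecomposition H m) where
  open TreeDecomposition t
  open RootedTree tree using (forest; parent)
  open TreeProperties tree

  ∈-adh⁻ : ∀ {x u} → T (u ∈ᵇ adh t x) → ∃[ p ] (parent x ≡ just p × u ∈ bag p)
  ∈-adh⁻ {x} {u} h with parent x
  ... | nothing = ⊥-elim (subst T (lookup∘tabulate _ u) h)
  ... | just p  =
    p , refl , ∈ᵇ⁻ (proj₂ (∧⁻ (u ∈ᵇ bag x) (∈-tabulate⁻ {f = λ u → u ∈ᵇ bag x ∧ u ∈ᵇ bag p} (∈ᵇ⁻ h))))

  ∈-adh⁺ : ∀ {x u p} → parent x ≡ just p → u ∈ bag x → u ∈ bag p → T (u ∈ᵇ adh t x)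
  ∈-adh⁺ {x} {u} {p} x→p u∈x u∈p with parent x | x→p
  ... | just .p | refl = ∈ᵇ⁺ (∈-tabulate⁺ {f = λ u → u ∈ᵇ bag x ∧ u ∈ᵇ bag p} (∧⁺ (∈ᵇ⁺ u∈x) (∈ᵇ⁺ u∈p)))

  IsMn⁻ : ∀ {u x} → IsMn t u x → u ∈ bag x × (∀ {p} → parent x ≡ just p → u ∉ bag p)
  IsMn⁻ {u} {x} h with ∧⁻ (u ∈ᵇ bag x) (subst T (lookup∘tabulate _ u) h)
  ... | u∈x , not-adh = ∈ᵇ⁻ u∈x , λ x→p u∈p → not⁻ not-adh (∈-adh⁺ x→p (∈ᵇ⁻ u∈x) u∈p)

  IsMn⁺ : ∀ {u x} → u ∈ bag x → (∀ {p} → parent x ≡ just p → u ∉ bag p) → IsMn t u x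
  IsMn⁺ {u} {x} u∈x highest = ∈ᵇ⁺ (∈-tabulate⁺ {f = λ u → u ∈ᵇ bag x ∧ not (u ∈ᵇ adh t x)}
    (∧⁺ (∈ᵇ⁺ u∈x) (not⁺ λ in-adh → let p , x→p , u∈p = ∈-adh⁻ in-adh in highest x→p u∈p)))

  some-bag : ∀ u → ∃[ x ] (u ∈ bag x)
  some-bag u with find (Hypergraph.covered H u)
  ... | e , e∈edges , u∈e with All.lookup cover e∈edges
  ... | x , e⊆bag = x , e⊆bag u∈e

  mn-exists : ∀ u → ∃[ x ] IsMn t u x
  mn-exists u with highest-ancestor (λ x → u ∈? bag x) (proj₂ (some-bag u))
  ... | r , _ , u∈r , highest = r , IsMn⁺ u∈r highest

  -- Kept abstract: unfolding mn would run the search for the highest bag during type checking.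
  abstract
    mn : Fin n → Fin m
    mn u = proj₁ (mn-exists u)

    IsMn-mn : ∀ u → IsMn t u (mn u)
    IsMn-mn u = proj₂ (mn-exists u)

  -- The bags containing u form a subtree, which a walk out of its top node would leave.
  IsMn-≼ : ∀ {u a a'} → IsMn t u a → u ∈ bag a' → a ≼ a'
  IsMn-≼ {u} {a} {a'} mn-a u∈a' with a ≼? a'
  ... | yes a≼a' = a≼a'
  ... | no  a⋠a' with conn u a a' (proj₁ (IsMn⁻ mn-a)) u∈a'
  ... | p , w , all-contain with walk-leaves w ≼-refl a⋠a'
  ... | _ , pa , a→pa , pa∈ = ⊥-elim (proj₂ (IsMn⁻ mn-a) a→pa (All.lookup all-contain pa∈))

  IsMn-unique : ∀ {u a a'} → IsMn t u a → IsMn t u a' → a ≡ a'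
  IsMn-unique mn-a mn-a' = ≼-antisym (IsMn-≼ mn-a (proj₁ (IsMn⁻ mn-a'))) (IsMn-≼ mn-a' (proj₁ (IsMn⁻ mn-a)))

  ∈-cmp⁺ : ∀ {x u} → x ≼ mn u → u ∈ cmp t x
  ∈-cmp⁺ {x} {u} x≼mn = ∈-tabulate⁺ {f = λ u → anyFin (λ y → ancᵇ forest x y ∧ (u ∈ᵇ mrg t y))}
    (anyFin⁺ (λ y → ancᵇ forest x y ∧ (u ∈ᵇ mrg t y)) (mn u) (∧⁺ (ancᵇ⁺ x≼mn) (IsMn-mn u)))

  ∈-cmp⁻ : ∀ {x u} → u ∈ cmp t x → x ≼ mn u
  ∈-cmp⁻ {x} {u} u∈ with anyFin⁻ (λ y → ancᵇ forest x y ∧ (u ∈ᵇ mrg t y))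
                               (∈-tabulate⁻ {f = λ u → anyFin (λ y → ancᵇ forest x y ∧ (u ∈ᵇ mrg t y))} u∈)
  ... | y , h with ∧⁻ (ancᵇ forest x y) h
  ... | x≼y , mn-y rewrite IsMn-unique mn-y (IsMn-mn u) = ancᵇ⁻ x≼y

module FactorProperties {n : ℕ} (F : RootedForest n) where
  open RootedForest F
  open Ancestry F

  Siblings : Subset n → Set
  Siblings R = ∀ {r r'} → r ∈ R → r' ∈ R → parent r ≡ parent r'

  -- F_top with the subtrees rooted in cut removed; tree factors are those with cut = ∅.
  record PrunedTree (M : Subset n) : Set where
    field
      top      : Fin n
      cut      : Subset n
      siblings : Siblings cut
      members  : ∀ {w} → w ∈ M → top ≼ w × (∀ {r} → r ∈ cut → ¬ r ≼ w)
      complete : ∀ {w} → top ≼ w → (∀ {r} → r ∈ cut → ¬ r ≼ w) → w ∈ M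

  record TreeUnion (M : Subset n) : Set where
    field
      roots    : Subset n
      siblings : Siblings roots
      members  : ∀ {w} → w ∈ M → ∃[ r ] (r ∈ roots × r ≼ w)
      complete : ∀ {w r} → r ∈ roots → r ≼ w → w ∈ M

  siblingsᵇ⁻ : ∀ {R} → T (siblingsᵇ F R) → Siblings R
  siblingsᵇ⁻ {R} h {r} {r'} r∈ r'∈ = eqMaybeᵇ⁻ (implies⁻ (r ∈ᵇ R ∧ r' ∈ᵇ R)
    (allFin⁻ (λ r' → not (r ∈ᵇ R ∧ r' ∈ᵇ R) ∨ eqMaybeᵇ (parent r) (parent r'))
      (allFin⁻ (λ r → allFin? (λ r' → not (r ∈ᵇ R ∧ r' ∈ᵇ R) ∨ eqMaybeᵇ (parent r) (parent r'))) h r) r')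
    (∧⁺ (∈ᵇ⁺ r∈) (∈ᵇ⁺ r'∈)))

  siblingsᵇ⁺ : ∀ {R} → Siblings R → T (siblingsᵇ F R)
  siblingsᵇ⁺ {R} sib = allFin⁺ _ λ r → allFin⁺ _ λ r' → implies⁺ (r ∈ᵇ R ∧ r' ∈ᵇ R) λ both →
    let r∈ , r'∈ = ∧⁻ (r ∈ᵇ R) both in eqMaybeᵇ⁺ (sib (∈ᵇ⁻ r∈) (∈ᵇ⁻ r'∈))

  ∈-unionTrees⁻ : ∀ {R w} → w ∈ unionTrees F R → ∃[ r ] (r ∈ R × r ≼ w)
  ∈-unionTrees⁻ {R} {w} w∈ with anyFin⁻ (λ r → r ∈ᵇ R ∧ ancᵇ F r w)
                                  (∈-tabulate⁻ {f = λ y → anyFin (λ r → r ∈ᵇ R ∧ ancᵇ F r y)} w∈)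
  ... | r , h = let r∈ , r≼w = ∧⁻ (r ∈ᵇ R) h in r , ∈ᵇ⁻ r∈ , ancᵇ⁻ r≼w

  ∈-unionTrees⁺ : ∀ {R w r} → r ∈ R → r ≼ w → w ∈ unionTrees F R
  ∈-unionTrees⁺ {R} {w} {r} r∈ r≼w = ∈-tabulate⁺ {f = λ y → anyFin (λ r → r ∈ᵇ R ∧ ancᵇ F r y)}
    (anyFin⁺ (λ r → r ∈ᵇ R ∧ ancᵇ F r w) r (∧⁺ (∈ᵇ⁺ r∈) (ancᵇ⁺ r≼w)))

  pruned : Fin n → Subset n → Subset n
  pruned x R = tabulate (λ y → (y ∈ᵇ treeF F x) ∧ not (y ∈ᵇ unionTrees F R))

  ∈-pruned⁻ : ∀ {x R w} → w ∈ pruned x R → x ≼ w × (∀ {r} → r ∈ R → ¬ r ≼ w)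
  ∈-pruned⁻ {x} {R} {w} w∈
    with ∧⁻ (w ∈ᵇ treeF F x) (∈-tabulate⁻ {f = λ y → (y ∈ᵇ treeF F x) ∧ not (y ∈ᵇ unionTrees F R)} w∈)
  ... | below-x , not-cut = ∈-treeF⁻ (∈ᵇ⁻ below-x) , λ r∈ r≼w → not⁻ not-cut (∈ᵇ⁺ (∈-unionTrees⁺ r∈ r≼w))

  ∈-pruned⁺ : ∀ {x R w} → x ≼ w → (∀ {r} → r ∈ R → ¬ r ≼ w) → w ∈ pruned x R
  ∈-pruned⁺ {x} {R} {w} x≼w uncut = ∈-tabulate⁺ {f = λ y → (y ∈ᵇ treeF F x) ∧ not (y ∈ᵇ unionTrees F R)}
    (∧⁺ (∈ᵇ⁺ (∈-treeF⁺ x≼w)) (not⁺ λ w∈ → let r , r∈ , r≼w = ∈-unionTrees⁻ (∈ᵇ⁻ w∈) in uncut r∈ r≼w))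

  isTreeFactor⇒PrunedTree : ∀ {M} → T (isTreeFactor F M) → PrunedTree M
  isTreeFactor⇒PrunedTree {M} h with anyFin⁻ (λ x → M ==ᵇ treeF F x) h
  ... | x , eq with ==ᵇ⁻ {S = M} eq
  ... | M⊆ , ⊆M = record
    { top      = x
    ; cut      = ∅
    ; siblings = λ r∈ → ⊥-elim (∉⊥ r∈)
    ; members  = λ w∈ → ∈-treeF⁻ (M⊆ w∈) , λ r∈ → ⊥-elim (∉⊥ r∈)
    ; complete = λ x≼w _ → ⊆M (∈-treeF⁺ x≼w)
    }

  isContextFactor⇒PrunedTree : ∀ {M} → T (isContextFactor F M) → PrunedTree M
  isContextFactor⇒PrunedTree {M} h with anyFin⁻ _ h
  ... | x , h' with anySubset⁻ _ h'
  ... | R , c with ∧⁻ (nonemptyᵇ R) c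
  ... | _ , c' with ∧⁻ (siblingsᵇ F R) c'
  ... | sib , c'' with ∧⁻ (allFin? (λ r → not (r ∈ᵇ R) ∨ sancᵇ F x r)) c''
  ... | _ , eq with ==ᵇ⁻ {S = M} {pruned x R} eq
  ... | M⊆ , ⊆M = record
    { top      = x
    ; cut      = R
    ; siblings = siblingsᵇ⁻ sib
    ; members  = λ w∈ → ∈-pruned⁻ (M⊆ w∈)
    ; complete = λ x≼w uncut → ⊆M (∈-pruned⁺ x≼w uncut)
    }

  isForestFactor⇒TreeUnion : ∀ {M} → T (isForestFactor F M) → TreeUnion M
  isForestFactor⇒TreeUnion {M} h with anySubset⁻ _ h
  ... | R , c with ∧⁻ (nonemptyᵇ R) c
  ... | _ , c' with ∧⁻ (siblingsᵇ F R) c'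
  ... | sib , eq with ==ᵇ⁻ {S = M} {unionTrees F R} eq
  ... | M⊆ , ⊆M = record
    { roots    = R
    ; siblings = siblingsᵇ⁻ sib
    ; members  = λ w∈ → ∈-unionTrees⁻ (M⊆ w∈)
    ; complete = λ r∈ r≼w → ⊆M (∈-unionTrees⁺ r∈ r≼w)
    }

  isFactor⇒shape : ∀ {M} → T (isFactor F M) → PrunedTree M ⊎ TreeUnion M
  isFactor⇒shape {M} h with ∨⁻ (isTreeFactor F M) h
  ... | inj₁ tree = inj₁ (isTreeFactor⇒PrunedTree tree)
  ... | inj₂ h' with ∨⁻ (isForestFactor F M) h'
  ... | inj₁ forest  = inj₂ (isForestFactor⇒TreeUnion forest)
  ... | inj₂ context = inj₁ (isContextFactor⇒PrunedTree context)

  ExitsTo : Subset n → Fin n → Set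
  ExitsTo M p = p ∉ M × ∃[ r ] (r ∈ M × parent r ≡ just p)

  EntersAt : Subset n → Fin n → Set
  EntersAt M u = u ∈ M × ∃[ v ] (v ∉ M × parent v ≡ just u)

  exit-from-top : ∀ {M} (P : PrunedTree M) → ∀ {r p} → r ∈ M → parent r ≡ just p → p ∉ M → r ≡ PrunedTree.top P
  exit-from-top P r∈ r→p p∉ with PrunedTree.members P r∈
  ... | top≼r , uncut with ≼⇒≼parent⊎≡ r→p top≼r
  ... | inj₁ top≼p = ⊥-elim (p∉ (PrunedTree.complete P top≼p λ ρ∈ ρ≼p → uncut ρ∈ (≼-trans ρ≼p (parent-≼ r→p))))
  ... | inj₂ top≡r = sym top≡r

  exit-from-root : ∀ {M} (G : TreeUnion M) → ∀ {r p} → r ∈ M → parent r ≡ just p → p ∉ M → r ∈ TreeUnion.roots G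
  exit-from-root G r∈ r→p p∉ with TreeUnion.members G r∈
  ... | ρ , ρ∈ , ρ≼r with ≼⇒≼parent⊎≡ r→p ρ≼r
  ... | inj₁ ρ≼p  = ⊥-elim (p∉ (TreeUnion.complete G ρ∈ ρ≼p))
  ... | inj₂ refl = ρ∈

  ExitsTo-unique : ∀ {M p p'} → PrunedTree M ⊎ TreeUnion M → ExitsTo M p → ExitsTo M p' → p ≡ p'
  ExitsTo-unique (inj₁ P) (p∉ , r , r∈ , r→p) (p'∉ , r' , r'∈ , r'→p')
    with exit-from-top P r∈ r→p p∉ | exit-from-top P r'∈ r'→p' p'∉
  ... | refl | refl = just-injective (trans (sym r→p) r'→p')
  ExitsTo-unique (inj₂ G) (p∉ , r , r∈ , r→p) (p'∉ , r' , r'∈ , r'→p') =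
    just-injective (trans (sym r→p) (trans same-parent r'→p'))
    where
    same-parent : parent r ≡ parent r'
    same-parent = TreeUnion.siblings G (exit-from-root G r∈ r→p p∉) (exit-from-root G r'∈ r'→p' p'∉)

  entered-child-∈-cut : ∀ {M} (P : PrunedTree M) → ∀ {u v} → u ∈ M → v ∉ M → parent v ≡ just u → v ∈ PrunedTree.cut P
  entered-child-∈-cut P {u} {v} u∈ v∉ v→u with v ∈? PrunedTree.cut P
  ... | yes v∈cut = v∈cut
  ... | no  v∉cut = ⊥-elim (v∉ (PrunedTree.complete P (≼-trans top≼u (parent-≼ v→u)) uncut-v))
    where
    top≼u = proj₁ (PrunedTree.members P u∈)
    uncut-v : ∀ {r} → r ∈ PrunedTree.cut P → ¬ r ≼ v
    uncut-v r∈ r≼v with ≼⇒≼parent⊎≡ v→u r≼v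
    ... | inj₁ r≼u  = proj₂ (PrunedTree.members P u∈) r∈ r≼u
    ... | inj₂ refl = v∉cut r∈

  no-entry-into-tree-union : ∀ {M} → TreeUnion M → ∀ {u v} → u ∈ M → v ∉ M → parent v ≡ just u → ⊥
  no-entry-into-tree-union G u∈ v∉ v→u with TreeUnion.members G u∈
  ... | ρ , ρ∈ , ρ≼u = v∉ (TreeUnion.complete G ρ∈ (≼-trans ρ≼u (parent-≼ v→u)))

  EntersAt-unique : ∀ {M u u'} → T (isFactor F M) → EntersAt M u → EntersAt M u' → u ≡ u'
  EntersAt-unique fac (u∈ , v , v∉ , v→u) (u'∈ , v' , v'∉ , v'→u') with isFactor⇒shape fac
  ... | inj₁ P = just-injective (trans (sym v→u) (trans same-parent v'→u'))
    where
    same-parent : parent v ≡ parent v'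
    same-parent = PrunedTree.siblings P (entered-child-∈-cut P u∈ v∉ v→u) (entered-child-∈-cut P u'∈ v'∉ v'→u')
  ... | inj₂ G = ⊥-elim (no-entry-into-tree-union G u∈ v∉ v→u)

  EntersAt⇒isContextFactor : ∀ {M u} → T (isFactor F M) → EntersAt M u → T (isContextFactor F M)
  EntersAt⇒isContextFactor {M} fac (u∈ , v , v∉ , v→u) with ∨⁻ (isTreeFactor F M) fac
  ... | inj₁ tree = ⊥-elim (∉⊥ (entered-child-∈-cut (isTreeFactor⇒PrunedTree tree) u∈ v∉ v→u))
  ... | inj₂ fac' with ∨⁻ (isForestFactor F M) fac'
  ... | inj₁ forest  = ⊥-elim (no-entry-into-tree-union (isForestFactor⇒TreeUnion forest) u∈ v∉ v→u)
  ... | inj₂ context = context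

  only-self-below : ∀ {v w} → v ≼ w → (∀ {y} → parent y ≡ just v → ¬ y ≼ w) → w ≡ v
  only-self-below {v} {w} v≼w childless-below with v ≟ w
  ... | yes v≡w = sym v≡w
  ... | no  v≢w = let y , y→v , y≼w = ≺-child v≼w v≢w in ⊥-elim (childless-below y→v y≼w)

  children : Fin n → Subset n
  children v = tabulate (λ y → eqMaybeᵇ (parent y) (just v))

  ∈-children⁺ : ∀ {v y} → parent y ≡ just v → y ∈ children v
  ∈-children⁺ {v} y→v = ∈-tabulate⁺ {f = λ y → eqMaybeᵇ (parent y) (just v)} (eqMaybeᵇ⁺ y→v)

  ∈-children⁻ : ∀ {v y} → y ∈ children v → parent y ≡ just v
  ∈-children⁻ {v} y∈ = eqMaybeᵇ⁻ (∈-tabulate⁻ {f = λ y → eqMaybeᵇ (parent y) (just v)} y∈)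

  -- A leaf v is the tree factor F_v; otherwise {v} is F_v with the subtrees of its children removed.
  ⁅⁆-isFactor : ∀ v → T (isFactor F ⁅ v ⁆)
  ⁅⁆-isFactor v with any? (λ y → ≡-dec-Maybe _≟_ (parent y) (just v))
  ... | no childless = ∨⁺ˡ _ (anyFin⁺ (λ x → ⁅ v ⁆ ==ᵇ treeF F x) v (==ᵇ⁺ single⊆tree tree⊆single))
    where
    single⊆tree : ⁅ v ⁆ ⊆ treeF F v
    single⊆tree w∈ rewrite x∈⁅y⁆⇒x≡y v w∈ = ∈-treeF⁺ ≼-refl
    tree⊆single : treeF F v ⊆ ⁅ v ⁆
    tree⊆single w∈ rewrite only-self-below (∈-treeF⁻ w∈) (λ y→v _ → childless (_ , y→v)) = x∈⁅x⁆ v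
  ... | yes (y , y→v) = ∨⁺ʳ (isTreeFactor F ⁅ v ⁆) (∨⁺ʳ (isForestFactor F ⁅ v ⁆)
        (anyFin⁺ _ v (anySubset⁺ _ (children v) (∧⁺ nonempty (∧⁺ sibling (∧⁺ strict single≡pruned))))))
    where
    nonempty : T (nonemptyᵇ (children v))
    nonempty = anyFin⁺ (λ u → u ∈ᵇ children v) y (∈ᵇ⁺ (∈-children⁺ y→v))
    sibling : T (siblingsᵇ F (children v))
    sibling = siblingsᵇ⁺ (λ r∈ r'∈ → trans (∈-children⁻ r∈) (sym (∈-children⁻ r'∈)))
    strict : T (allFin? (λ r → not (r ∈ᵇ children v) ∨ sancᵇ F v r))
    strict = allFin⁺ _ λ r → implies⁺ (r ∈ᵇ children v) λ r∈ →
      ∧⁺ (ancᵇ⁺ (parent-≼ (∈-children⁻ (∈ᵇ⁻ r∈))))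
         (not⁺ λ v≡r → child-⋠ (∈-children⁻ (∈ᵇ⁻ r∈)) (subst (_≼ v) (eqFinᵇ⁻ v≡r) ≼-refl))
    single≡pruned : T (⁅ v ⁆ ==ᵇ pruned v (children v))
    single≡pruned = ==ᵇ⁺
      (λ w∈ → subst (_∈ pruned v (children v)) (sym (x∈⁅y⁆⇒x≡y v w∈))
                (∈-pruned⁺ ≼-refl λ r∈ r≼v → child-⋠ (∈-children⁻ r∈) r≼v))
      (λ w∈ → let v≼w , uncut = ∈-pruned⁻ w∈ in
              subst (_∈ ⁅ v ⁆) (sym (only-self-below v≼w λ y→v y≼w → uncut (∈-children⁺ y→v) y≼w)) (x∈⁅x⁆ v))

  FactorIn : Subset n → Subset n → Set
  FactorIn U S = T (isFactor F S) × S ⊆ U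

  maximal⇒isMF : ∀ {U M} → Maximal (FactorIn U) M → T (isMF F U M)
  maximal⇒isMF {U} {M} ((fac , M⊆U) , maximal) = ∧⁺ fac (∧⁺ (⊆ᵇ⁺ M⊆U) (not⁺ no-larger))
    where
    no-larger : ¬ T (anySubset (λ S → isFactor F S ∧ (M ⊆ᵇ S) ∧ not (M ==ᵇ S) ∧ (S ⊆ᵇ U)))
    no-larger h with anySubset⁻ _ h
    ... | S , c with ∧⁻ (isFactor F S) c
    ... | fac-S , c' with ∧⁻ (M ⊆ᵇ S) c'
    ... | M⊆S , c'' with ∧⁻ (not (M ==ᵇ S)) c''
    ... | M≢S , S⊆U = not⁻ M≢S (==ᵇ⁺ (⊆ᵇ⁻ {S = M} M⊆S) (maximal (fac-S , ⊆ᵇ⁻ {S = S} S⊆U) (⊆ᵇ⁻ {S = M} M⊆S)))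

  isMF⇒FactorIn : ∀ {U M} → T (isMF F U M) → FactorIn U M
  isMF⇒FactorIn {U} {M} h with ∧⁻ (isFactor F M) h
  ... | fac , h' = fac , ⊆ᵇ⁻ {S = M} (proj₁ (∧⁻ (M ⊆ᵇ U) h'))

  maximal-factor-containing : ∀ {U v} → v ∈ U → ∃[ M ] (T (isMF F U M) × v ∈ M)
  maximal-factor-containing {U} {v} v∈U
    with maximal-above (λ S → T? (isFactor F S) ×-dec S ⊆? U)
                       (⁅⁆-isFactor v , λ w∈ → subst (_∈ U) (sym (x∈⁅y⁆⇒x≡y v w∈)) v∈U)
  ... | M , ⁅v⁆⊆M , maximal = M , maximal⇒isMF maximal , ⁅v⁆⊆M (x∈⁅x⁆ v)

  maximalFactors : Subset n → List (Subset n)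
  maximalFactors U = filter (λ S → T? (isMF F U S)) (allSubsets n)

  ExitsTo? : ∀ M → Dec (∃ (ExitsTo M))
  ExitsTo? M = any? λ p → ¬? (p ∈? M) ×-dec any? λ r → r ∈? M ×-dec ≡-dec-Maybe _≟_ (parent r) (just p)

  EntersAt? : ∀ M → Dec (∃ (EntersAt M))
  EntersAt? M = any? λ u → u ∈? M ×-dec any? λ v → ¬? (v ∈? M) ×-dec ≡-dec-Maybe _≟_ (parent v) (just u)

  exitPoints : Subset n → List (Fin n)
  exitPoints U = witnesses ExitsTo ExitsTo? (maximalFactors U)

  entryPoints : Subset n → List (Fin n)
  entryPoints U = witnesses EntersAt EntersAt? (maximalFactors U)

  length-exitPoints : ∀ U → length (exitPoints U) ≤ numMF F U
  length-exitPoints U = length-witnesses ExitsTo ExitsTo? (maximalFactors U)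

  length-entryPoints : ∀ U → length (entryPoints U) ≤ numMF F U
  length-entryPoints U = length-witnesses EntersAt EntersAt? (maximalFactors U)

  ∈-maximalFactors : ∀ {U M} → T (isMF F U M) → M ∈ˡ maximalFactors U
  ∈-maximalFactors {U} {M} mf = ∈-filter⁺ (λ S → T? (isMF F U S)) {x = M} (∈-allSubsets M) mf

  exit-of-maximal-∈-exitPoints : ∀ {U M w} → T (isMF F U M) → ExitsTo M w → w ∈ˡ exitPoints U
  exit-of-maximal-∈-exitPoints {U} {M} {w} mf exit =
    ∈-witnesses ExitsTo ExitsTo? {a = M} {b = w} (∈-maximalFactors {U} mf) exit
      (λ exit' → ExitsTo-unique (isFactor⇒shape {M} (proj₁ (isMF⇒FactorIn {U} {M} mf))) exit' exit)

  entry-of-maximal-∈-entryPoints : ∀ {U M w} → T (isMF F U M) → EntersAt M w → w ∈ˡ entryPoints U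
  entry-of-maximal-∈-entryPoints {U} {M} {w} mf entry =
    ∈-witnesses EntersAt EntersAt? {a = M} {b = w} (∈-maximalFactors {U} mf) entry
      (λ entry' → EntersAt-unique {M} (proj₁ (isMF⇒FactorIn {U} {M} mf)) entry' entry)

  entry-of-maximal-¬wellFormed : ∀ {U M w} → T (isMF F U M) → EntersAt M w → ¬ T (wellFormed F U)
  entry-of-maximal-¬wellFormed {U} {M} mf entry wf =
    not⁻ (implies⁻ (isMF F U M) (allSubset⁻ (λ S → not (isMF F U S) ∨ not (isContextFactor F S)) wf M) mf)
         (EntersAt⇒isContextFactor {M} (proj₁ (isMF⇒FactorIn {U} {M} mf)) entry)

  ∈-exitPoints : ∀ {U v w} → v ∈ U → parent v ≡ just w → w ∉ U → w ∈ˡ exitPoints U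
  ∈-exitPoints {U} {v} {w} v∈U v→w w∉U =
    let M , mf , v∈M = maximal-factor-containing {U} v∈U
    in exit-of-maximal-∈-exitPoints {U} {M} mf
         ((λ w∈M → w∉U (proj₂ (isMF⇒FactorIn {U} {M} mf) w∈M)) , v , v∈M , v→w)

  ∈-entryPoints : ∀ {U v w} → w ∈ U → parent v ≡ just w → v ∉ U → w ∈ˡ entryPoints U × ¬ T (wellFormed F U)
  ∈-entryPoints {U} {v} {w} w∈U v→w v∉U =
    let M , mf , w∈M = maximal-factor-containing {U} w∈U
        entry = w∈M , v , (λ v∈M → v∉U (proj₂ (isMF⇒FactorIn {U} {M} mf) v∈M)) , v→w
    in entry-of-maximal-∈-entryPoints {U} {M} mf entry , entry-of-maximal-¬wellFormed {U} {M} mf entry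

module ConflictGraph {n : ℕ} {H : Hypergraph n} {m : ℕ} (t : TreeDecomposition H m) (F : EliminationForest H)
                     where
  open TreeDecomposition t
  open RootedTree tree using (parent)
  open TreeProperties tree
  open DecompositionProperties t
  private
    Fo = EliminationForest.forest F
    module Fo = FactorProperties Fo

  -- z lies on the tree path between a and b.
  Between : Fin m → Fin m → Fin m → Set
  Between a b z = (z ≼ a ⊎ z ≼ b) × (∀ c → c ≼ a → c ≼ b → c ≼ z)

  Between? : ∀ a b z → Dec (Between a b z)
  Between? a b z = (z ≼? a ⊎-dec z ≼? b) ×-dec all? (λ c → c ≼? a →-dec c ≼? b →-dec c ≼? z)

  -- The stain of w, with tree paths described through ancestry.
  Hull : Fin n → Fin m → Set
  Hull w z = ∃[ v ] ((v ≡ w ⊎ RootedForest.parent Fo v ≡ just w) × Between (mn w) (mn v) z)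

  Hull? : ∀ w z → Dec (Hull w z)
  Hull? w z = any? λ v → (v ≟ w ⊎-dec ≡-dec-Maybe _≟_ (RootedForest.parent Fo v) (just w))
                         ×-dec Between? (mn w) (mn v) z

  hull-mn : ∀ w → Hull w (mn w)
  hull-mn w = w , inj₁ refl , inj₁ ≼-refl , λ _ c≼a _ → c≼a

  stain⊆hull : ∀ {w z} → InStain t F w z → Hull w z
  stain⊆hull {w} (a , mn-a , inj₁ refl) rewrite IsMn-unique mn-a (IsMn-mn w) = hull-mn w
  stain⊆hull {w} (a , mn-a , inj₂ (v , v→w , b , mn-b , on-path))
    with IsMn-unique mn-a (IsMn-mn w) | IsMn-unique mn-b (IsMn-mn v)
  ... | refl | refl = v , inj₂ v→w , on-path-≼ on-path , λ _ → common-ancestor-≼-on-path on-path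

  hull-upward : ∀ {w x y} → Hull w x → x ≼ mn w → x ≼ y → y ≼ mn w → Hull w y
  hull-upward (v , v~w , _ , common) x≼mn x≼y y≼mn =
    v , v~w , inj₁ y≼mn , λ c c≼a c≼b → ≼-trans (common c c≼a c≼b) x≼y

  -- Abstract for the same reason as mn.
  abstract
    apex : Fin n → Fin m
    apex w = proj₁ (highest-ancestor (Hull? w) (hull-mn w))

    apex-≼-mn : ∀ w → apex w ≼ mn w
    apex-≼-mn w = proj₁ (proj₂ (highest-ancestor (Hull? w) (hull-mn w)))

    hull-apex : ∀ w → Hull w (apex w)
    hull-apex w = proj₁ (proj₂ (proj₂ (highest-ancestor (Hull? w) (hull-mn w))))

    apex-highest : ∀ w {q} → parent (apex w) ≡ just q → ¬ Hull w q
    apex-highest w = proj₂ (proj₂ (proj₂ (highest-ancestor (Hull? w) (hull-mn w))))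

  apex-≼-hull-above-mn : ∀ {w x} → Hull w x → x ≼ mn w → apex w ≼ x
  apex-≼-hull-above-mn {w} {x} hull-x x≼mn with ≼-linear (apex-≼-mn w) x≼mn
  ... | inj₁ apex≼x = apex≼x
  ... | inj₂ x≼apex with x ≟ apex w
  ... | yes refl = ≼-refl
  ... | no  x≢apex = let q , apex→q , x≼q = ≺-parent x≼apex x≢apex in
    ⊥-elim (apex-highest w apex→q (hull-upward hull-x x≼mn x≼q (≼-trans (parent-≼ apex→q) (apex-≼-mn w))))

  apex-≼ : ∀ {w z} → Hull w z → apex w ≼ z
  apex-≼ {w} {z} hull-z with z ≼? mn w
  ... | yes z≼mn = apex-≼-hull-above-mn hull-z z≼mn
  ... | no  _ with hull-z
  ... | v , v~w , _ , common with lowest-common-ancestor (mn w) (mn v)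
  ... | c , c≼a , c≼b , lowest =
    ≼-trans (apex-≼-hull-above-mn (v , v~w , inj₁ c≼a , λ c' → lowest) c≼a) (common c c≼a c≼b)

  hull-convex : ∀ {w x z} → Hull w z → apex w ≼ x → x ≼ z → Hull w x
  hull-convex {w} {x} {z} hull-z apex≼x x≼z with x ≼? mn w | hull-z
  ... | yes x≼mn | _ = let v , v~w , _ , common = hull-apex w in
                       v , v~w , inj₁ x≼mn , λ c c≼a c≼b → ≼-trans (common c c≼a c≼b) apex≼x
  ... | no  x⋠mn | v , v~w , side , common = v , v~w , inj₂ (≼-trans x≼z z≼b) , below-x
    where
    z≼b : z ≼ mn v
    z≼b = [ (λ z≼a → ⊥-elim (x⋠mn (≼-trans x≼z z≼a))) , (λ z≼b → z≼b) ] side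
    below-x : ∀ c → c ≼ mn w → c ≼ mn v → c ≼ x
    below-x c c≼a c≼b with ≼-linear (common c c≼a c≼b) x≼z
    ... | inj₁ c≼x = c≼x
    ... | inj₂ x≼c = ⊥-elim (x⋠mn (≼-trans x≼c c≼a))

  bagMembers : Fin m → List (Fin n)
  bagMembers z = filter (λ u → T? (u ∈ᵇ bag z)) (allFin n)

  irregularChildren : Fin m → List (Fin m)
  irregularChildren z =
    filter (λ y → T? (eqMaybeᵇ (parent y) (just z) ∧ not (wellFormed Fo (cmp t y)))) (allFin m)

  entryCandidates : Fin m → List (Fin n)
  entryCandidates z = concatMap (λ y → Fo.entryPoints (cmp t y)) (irregularChildren z)

  candidates : Fin m → List (Fin n)
  candidates z = bagMembers z ++ Fo.exitPoints (cmp t z) ++ entryCandidates z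

  hull-below-∈-entryCandidates : ∀ {w z} → Hull w z → z ≼ mn w → z ≢ mn w → w ∈ˡ entryCandidates z
  hull-below-∈-entryCandidates {w} {z} (v , v~w , _ , common) z≼mn z≢mn =
    ∈-concatMap⁺ (λ y → Fo.entryPoints (cmp t y)) (lose y-irregular (proj₁ boundary))
    where
    -- y is the child of z towards mn w; its subtree contains mn w but not mn v.
    child = ≺-child z≼mn z≢mn
    y = proj₁ child
    y→z : parent y ≡ just z
    y→z = proj₁ (proj₂ child)
    y≼mn : y ≼ mn w
    y≼mn = proj₂ (proj₂ child)
    y⋠b : ¬ y ≼ mn v
    y⋠b y≼b = child-⋠ y→z (common y y≼mn y≼b)
    v→w : RootedForest.parent Fo v ≡ just w
    v→w = [ (λ { refl → ⊥-elim (y⋠b y≼mn) }) , (λ v→w → v→w) ] v~w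
    boundary : w ∈ˡ Fo.entryPoints (cmp t y) × ¬ T (wellFormed Fo (cmp t y))
    boundary = Fo.∈-entryPoints (∈-cmp⁺ y≼mn) v→w (λ v∈ → y⋠b (∈-cmp⁻ v∈))
    y-irregular : y ∈ˡ irregularChildren z
    y-irregular = ∈-filter⁺ (λ y → T? (eqMaybeᵇ (parent y) (just z) ∧ not (wellFormed Fo (cmp t y))))
                            (∈-allFin y) (∧⁺ (eqMaybeᵇ⁺ y→z) (not⁺ (proj₂ boundary)))

  hull-beside-∈-exitPoints : ∀ {w z} → Hull w z → ¬ z ≼ mn w → w ∈ˡ Fo.exitPoints (cmp t z)
  hull-beside-∈-exitPoints {w} {z} (v , v~w , side , _) z⋠mn =
    Fo.∈-exitPoints (∈-cmp⁺ z≼b) v→w (λ w∈ → z⋠mn (∈-cmp⁻ w∈))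
    where
    z≼b : z ≼ mn v
    z≼b = [ (λ z≼a → ⊥-elim (z⋠mn z≼a)) , (λ z≼b → z≼b) ] side
    v→w : RootedForest.parent Fo v ≡ just w
    v→w = [ (λ { refl → ⊥-elim (z⋠mn z≼b) }) , (λ v→w → v→w) ] v~w

  hull⊆candidates : ∀ {w z} → Hull w z → w ∈ˡ candidates z
  hull⊆candidates {w} {z} hull-z with z ≟ mn w | z ≼? mn w
  ... | yes refl | _ = ∈-++⁺ˡ (∈-filter⁺ (λ u → T? (u ∈ᵇ bag z)) (∈-allFin w) (∈ᵇ⁺ (proj₁ (IsMn⁻ (IsMn-mn w)))))
  ... | no z≢mn | yes z≼mn =
    ∈-++⁺ʳ (bagMembers z) (∈-++⁺ʳ (Fo.exitPoints (cmp t z)) (hull-below-∈-entryCandidates hull-z z≼mn z≢mn))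
  ... | no _    | no  z⋠mn = ∈-++⁺ʳ (bagMembers z) (∈-++⁺ˡ (hull-beside-∈-exitPoints hull-z z⋠mn))

  length-bagMembers : ∀ z → length (bagMembers z) ≤ suc (tw t)
  length-bagMembers z = begin
    length (bagMembers z)         ≡⟨ length-filter-tabulate (λ u → u ∈ᵇ bag z) (λ u → u) ⟩
    ∣ tabulate (lookup (bag z)) ∣ ≡⟨ cong ∣_∣ (tabulate∘lookup (bag z)) ⟩
    ∣ bag z ∣                     ≤⟨ maxFin-≥ (λ x → ∣ bag x ∣) z ⟩
    maxFin (λ x → ∣ bag x ∣)      ≤⟨ m≤n+m∸n _ 1 ⟩
    suc (tw t)                    ∎
    where open ≤-Reasoning

  numMF-≤-split : ∀ x → numMF Fo (cmp t x) ≤ split t F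
  numMF-≤-split = maxFin-≥ (λ x → numMF Fo (cmp t x))

  length-entryCandidates : ∀ z → length (entryCandidates z) ≤ mir t F * split t F
  length-entryCandidates z = ≤-trans
    (length-concatMap-≤ (λ y → Fo.entryPoints (cmp t y))
                        (λ y → ≤-trans (Fo.length-entryPoints (cmp t y)) (numMF-≤-split y)) (irregularChildren z))
    (*-monoˡ-≤ (split t F) (maxFin-≥ (irregularity t F) z))

  length-candidates : ∀ z → length (candidates z) ≤ suc (tw t) + (split t F + mir t F * split t F)
  length-candidates z = begin
    length (bagMembers z ++ exits ++ entryCandidates z)
      ≡⟨ length-++ (bagMembers z) ⟩
    length (bagMembers z) + length (exits ++ entryCandidates z)
      ≡⟨ cong (length (bagMembers z) +_) (length-++ exits) ⟩
    length (bagMembers z) + (length exits + length (entryCandidates z))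
      ≤⟨ +-mono-≤ (length-bagMembers z) (+-mono-≤ length-exits (length-entryCandidates z)) ⟩
    suc (tw t) + (split t F + mir t F * split t F)
      ∎
    where
    open ≤-Reasoning
    exits = Fo.exitPoints (cmp t z)
    length-exits : length exits ≤ split t F
    length-exits = ≤-trans (Fo.length-exitPoints (cmp t z)) (numMF-≤-split z)

  priority : Fin n → ℕ
  priority w = depth (apex w) * n + toℕ w

  earlier-hull-reaches-apex : ∀ {u w z} → Hull u z → Hull w z → priority w < priority u → Hull w (apex u)
  earlier-hull-reaches-apex {u} {w} hull-u hull-w w<u with ≼-linear (apex-≼ hull-w) (apex-≼ hull-u)
  ... | inj₁ aw≼au = hull-convex hull-w aw≼au (apex-≼ hull-u)
  ... | inj₂ au≼aw = subst (Hull w) (sym (≼-depth-≤⇒≡ au≼aw not-deeper)) (hull-apex w)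
    where
    not-deeper : depth (apex w) ≤ depth (apex u)
    not-deeper = radix-≤ {a = depth (apex w)} {depth (apex u)} w u w<u

  conflict-graph-colourable : Colourable (CGAdj t F) (suc (suc (tw t) + (split t F + mir t F * split t F)))
  conflict-graph-colourable = greedy-colourable (CGAdj t F) priority (λ u → candidates (apex u))
    (λ u → length-candidates (apex u))
    (λ (u≢w , z , stain-u , stain-w) → (λ w≡u → u≢w (sym w≡u)) , z , stain-w , stain-u)
    (λ {u} {w} (u≢w , _) same → u≢w (radix-injective {a = depth (apex u)} {depth (apex w)} u w same))
    (λ (_ , z , stain-u , stain-w) w<u →
       hull⊆candidates (earlier-hull-reaches-apex (stain⊆hull stain-u) (stain⊆hull stain-w) w<u))

η : ℕ → ℕ → ℕ → ℕ → ℕ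
η s i w _ = suc (suc w + (s + i * s))

η-monotone : Monotone4 η
η-monotone s≤s' i≤i' w≤w' _ = s≤s (+-mono-≤ (s≤s w≤w') (+-mono-≤ s≤s' (*-mono-≤ i≤i' s≤s')))

theorem13 : Σ (ℕ → ℕ → ℕ → ℕ → ℕ) (λ η → Monotone4 η ×
    ((n : ℕ) (H : Hypergraph n) (m : ℕ) (t : TreeDecomposition H m) (F : EliminationForest H) →
      Colourable (CGAdj t F) (η (split t F) (mir t F) (tw t) (rank H))))
theorem13 = η , η-monotone , λ n H m t F → ConflictGraph.conflict-graph-colourable t F
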